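{- Let $G$ be a graph in $\varepsilon_2$ with $p$ vertices and $q$ edges. Then $G$ is bipartite and $q\equiv 0$ or $2 \pmod 4$.
   Context: All graphs are finite, simple, undirected and connected. An Euler graph is a connected graph in which every vertex has even degree. $\varepsilon_2$ denotes the class of Euler graphs $G$ such that every cycle of $G$ has length $n\equiv 2 \pmod 4$. -}

module Defs where

open import Data.Nat using (ℕ; zero; suc; _<_; _≤_; _%_; _<ᵇ_)
open import Data.Nat.Divisibility using (_∣_)
open import Data.Fin using (Fin; zero; suc; toℕ; inject₁; fromℕ)
open import Data.Bool using (Bool; true; false; if_then_else_; _∧_; _≟_)
open import Data.List using (List; map; allFin)
open import Data.Nat.ListAction using (sum)
open import Data.Product using (Σ; _×_; ∃)
open import Function.Definitions using (Injective)
open import Relation.Binary.PropositionalEquality using (_≡_; _≢_)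

record Graph (n : ℕ) : Set where
  field
    Adj   : Fin n → Fin n → Bool
    sym   : ∀ u v → Adj u v ≡ Adj v u
    irrefl : ∀ v → Adj v v ≡ false
open Graph public

_~_ : ∀ {n} (G : Graph n) → Fin n → Fin n → Set
(G ~ u) v = Adj G u v ≡ true

degree : ∀ {n} → Graph n → Fin n → ℕ
degree {n} G v = sum (map (λ u → if Adj G v u then 1 else 0) (allFin n))

edgeCount : ∀ {n} → Graph n → ℕ
edgeCount {n} G =
  sum (map (λ i → sum (map (λ j → if (toℕ i <ᵇ toℕ j) ∧ Adj G i j then 1 else 0)
                           (allFin n)))
           (allFin n))

data Reach {n} (G : Graph n) : Fin n → Fin n → Set where
  here : ∀ {v} → Reach G v v
  step : ∀ {u v w} → (G ~ u) v → Reach G v w → Reach G u w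

Connected : ∀ {n} → Graph n → Set
Connected {n} G = ∀ (u v : Fin n) → Reach G u v

Euler : ∀ {n} → Graph n → Set
Euler G = Connected G × (∀ v → 2 ∣ degree G v)

-- A cycle of length (suc m) in G: an injective sequence of vertices
-- c 0, …, c m, of length ≥ 3, with consecutive vertices adjacent and
-- c m adjacent to c 0.
record Cycle {n} (G : Graph n) (m : ℕ) : Set where
  field
    vert      : Fin (suc m) → Fin n
    long      : 3 ≤ suc m
    injective : Injective _≡_ _≡_ vert
    consec    : ∀ (i : Fin m) → (G ~ vert (inject₁ i)) (vert (suc i))
    close     : (G ~ vert (fromℕ m)) (vert zero)

InE₂ : ∀ {n} → Graph n → Set
InE₂ G = Euler G × (∀ m → Cycle G m → suc m % 4 ≡ 2)

Bipartite : ∀ {n} → Graph n → Set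
Bipartite {n} G = Σ (Fin n → Bool) λ col → ∀ u v → (G ~ u) v → col u ≢ col v

-- Colour every vertex by the parity of the length of a walk reaching it from a fixed
-- root. An edge joining two vertices of the same colour would close a walk of odd
-- length, and an odd closed walk contains an odd cycle: at a repeated vertex it splits
-- into two shorter closed walks, one of which is odd. As all cycles of a graph in ε₂
-- are even, the colouring is proper. Every edge of a bipartite graph has exactly one
-- end of colour true, so q is a sum of degrees, which are even; an even q is 0 or 2
-- modulo 4.

module Submission where

open import Defs
open import Data.Nat using (ℕ; _%_)
open import Data.Sum using (_⊎_)
open import Data.Product using (_×_)
open import Relation.Binary.PropositionalEquality using (_≡_)

open import Algebra.Properties.CommutativeSemigroup using (x∙yz≈y∙xz)
open import Data.Bool using (Bool; true; false; not; _∧_; if_then_else_)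
open import Data.Bool.Properties using (¬-not)
open import Data.Empty using (⊥-elim)
open import Data.Fin using (Fin; zero; suc; toℕ; inject₁; fromℕ)
open import Data.Fin.Properties using (toℕ-injective; toℕ<n; toℕ-inject₁; toℕ-fromℕ) renaming (_≟_ to _≟ᶠ_)
open import Data.List using (map; allFin; tabulate)
open import Data.List.Properties using (map-tabulate)
open import Data.Nat using (zero; suc; _+_; _*_; _<_; _≤_; _/_; _<ᵇ_; z≤n; s≤s; parity)
open import Data.Nat.DivMod using (m≡m%n+[m/n]*n; m%n<n)
open import Data.Nat.Divisibility using (_∣_; divides)
open import Data.Nat.Induction using (<-wellFounded)
open import Data.Nat.Properties
  using (+-identityʳ; +-suc; m≤n+m; m<m+n; m<n+m; ≤-trans; *-cancelˡ-≡;
         +-commutativeSemigroup; +-0-commutativeMonoid)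
import Data.Nat.ListAction as List
open import Data.Parity using (Parity; 0ℙ; 1ℙ) renaming (_+_ to _⊕_; _*_ to _⊗_)
open import Data.Parity.Properties using (+-homo-+; *-homo-*; p+p≡0ℙ) renaming (+-identityʳ to ⊕-identityʳ; *-zeroʳ to ⊗-zeroʳ)
open import Data.Product using (Σ-syntax; _,_)
open import Data.Sum using (inj₁; inj₂)
open import Function using (_∘_; id)
open import Induction.WellFounded using (Acc; acc)
open import Relation.Binary.PropositionalEquality using (refl; trans; cong; cong₂; subst; _≢_; module ≡-Reasoning)
  renaming (sym to ≡-sym)
open import Relation.Nullary using (yes; no; contradiction)

open import Algebra.Properties.CommutativeMonoid.Sum +-0-commutativeMonoid
  using (sum-syntax; ∑-comm; ∑-distrib-+; sum-cong-≗; sum-replicate-zero)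

open ≡-Reasoning

parity-%4 : ∀ m → parity (m % 4) ≡ parity m
parity-%4 m = ≡-sym (begin
  parity m                                   ≡⟨ cong parity (m≡m%n+[m/n]*n m 4) ⟩
  parity (m % 4 + m / 4 * 4)                 ≡⟨ +-homo-+ (m % 4) (m / 4 * 4) ⟩
  parity (m % 4) ⊕ parity (m / 4 * 4)        ≡⟨ cong (parity (m % 4) ⊕_) (*-homo-* (m / 4) 4) ⟩
  parity (m % 4) ⊕ (parity (m / 4) ⊗ 0ℙ)     ≡⟨ cong (parity (m % 4) ⊕_) (⊗-zeroʳ (parity (m / 4))) ⟩
  parity (m % 4) ⊕ 0ℙ                        ≡⟨ ⊕-identityʳ (parity (m % 4)) ⟩
  parity (m % 4)                             ∎)

even⇒%4≡0∨2 : ∀ m → parity m ≡ 0ℙ → m % 4 ≡ 0 ⊎ m % 4 ≡ 2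
even⇒%4≡0∨2 m even = residue (m % 4) (m%n<n m 4) (trans (parity-%4 m) even)
  where
  residue : ∀ r → r < 4 → parity r ≡ 0ℙ → r ≡ 0 ⊎ r ≡ 2
  residue 0 _ _ = inj₁ refl
  residue 1 _ ()
  residue 2 _ _ = inj₂ refl
  residue 3 _ ()
  residue (suc (suc (suc (suc _)))) (s≤s (s≤s (s≤s (s≤s ())))) _

%4≡2⇒even : ∀ m → m % 4 ≡ 2 → parity m ≡ 0ℙ
%4≡2⇒even m m%4≡2 = trans (≡-sym (parity-%4 m)) (cong parity m%4≡2)

2∣⇒even : ∀ {m} → 2 ∣ m → parity m ≡ 0ℙ
2∣⇒even (divides k refl) = trans (*-homo-* k 2) (⊗-zeroʳ (parity k))

p⊕q≡1ℙ⇒p≡1ℙ⊎q≡1ℙ : ∀ {p q} → p ⊕ q ≡ 1ℙ → p ≡ 1ℙ ⊎ q ≡ 1ℙ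
p⊕q≡1ℙ⇒p≡1ℙ⊎q≡1ℙ {1ℙ} _ = inj₁ refl
p⊕q≡1ℙ⇒p≡1ℙ⊎q≡1ℙ {0ℙ} q≡1ℙ = inj₂ q≡1ℙ

isOdd : Parity → Bool
isOdd 0ℙ = false
isOdd 1ℙ = true

isOdd-injective : ∀ {p q} → isOdd p ≡ isOdd q → p ≡ q
isOdd-injective {0ℙ} {0ℙ} _ = refl
isOdd-injective {1ℙ} {1ℙ} _ = refl

module _ {n} (G : Graph n) where

  ~-sym : ∀ {u v} → (G ~ u) v → (G ~ v) u
  ~-sym {u} {v} u~v = trans (Graph.sym G v u) u~v

  ~⇒≢ : ∀ {u v} → (G ~ u) v → u ≢ v
  ~⇒≢ {u} u~u refl with trans (≡-sym u~u) (irrefl G u)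
  ... | ()

module Walk {n} (G : Graph n) where

  length : ∀ {u v} → Reach G u v → ℕ
  length here       = 0
  length (step _ r) = suc (length r)

  infixr 5 _++_
  _++_ : ∀ {u v w} → Reach G u v → Reach G v w → Reach G u w
  here       ++ s = s
  step e r   ++ s = step e (r ++ s)

  length-++ : ∀ {u v w} (r : Reach G u v) (s : Reach G v w) → length (r ++ s) ≡ length r + length s
  length-++ here       s = refl
  length-++ (step _ r) s = cong suc (length-++ r s)

  reverseAcc : ∀ {u v w} → Reach G u w → Reach G u v → Reach G v w
  reverseAcc t here       = t
  reverseAcc t (step e r) = reverseAcc (step (~-sym G e) t) r

  length-reverseAcc : ∀ {u v w} (t : Reach G u w) (r : Reach G u v) →
                      length (reverseAcc t r) ≡ length r + length t
  length-reverseAcc t here       = refl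
  length-reverseAcc t (step e r) = trans (length-reverseAcc _ r) (+-suc (length r) (length t))

  vertex : ∀ {u v} → Reach G u v → ℕ → Fin n
  vertex {u} here       _       = u
  vertex {u} (step _ _) zero    = u
  vertex     (step _ r) (suc k) = vertex r k

  vertex-zero : ∀ {u v} (r : Reach G u v) → vertex r 0 ≡ u
  vertex-zero here       = refl
  vertex-zero (step _ _) = refl

  vertex-length : ∀ {u v} (r : Reach G u v) → vertex r (length r) ≡ v
  vertex-length here       = refl
  vertex-length (step _ r) = vertex-length r

  vertex-adjacent : ∀ {u v} (r : Reach G u v) k → k < length r → (G ~ vertex r k) (vertex r (suc k))
  vertex-adjacent (step e r) zero    _         = subst (G ~ _) (≡-sym (vertex-zero r)) e
  vertex-adjacent (step _ r) (suc k) (s≤s k<l) = vertex-adjacent r k k<l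

  -- The endpoint is not compared, so for a closed walk this says that it is a cycle.
  DistinctVertices : ∀ {u v} → Reach G u v → Set
  DistinctVertices r = ∀ i j → i < length r → j < length r → vertex r i ≡ vertex r j → i ≡ j

  record Detour {u v} (r : Reach G u v) : Set where
    field
      junction        : Fin n
      prefix          : Reach G u junction
      loop            : Reach G junction junction
      suffix          : Reach G junction v
      splits          : r ≡ prefix ++ loop ++ suffix
      loop-nonempty   : 0 < length loop
      suffix-nonempty : 0 < length suffix

  detour-step : ∀ {u x v} (e : (G ~ u) x) {r : Reach G x v} → Detour r → Detour (step e r)
  detour-step e d = record
    { junction = junction ; prefix = step e prefix ; loop = loop ; suffix = suffix
    ; splits = cong (step e) splits
    ; loop-nonempty = loop-nonempty ; suffix-nonempty = suffix-nonempty
    }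
    where open Detour d

  splitAt? : ∀ {u v} (x : Fin n) (r : Reach G u v) →
             (Σ[ a ∈ Reach G u x ] Σ[ c ∈ Reach G x v ] r ≡ a ++ c × 0 < length c)
             ⊎ (∀ k → k < length r → vertex r k ≢ x)
  splitAt? x here = inj₂ λ _ ()
  splitAt? {u} x (step e r) with u ≟ᶠ x | splitAt? x r
  ... | yes refl | _                        = inj₁ (here , step e r , refl , s≤s z≤n)
  ... | no _     | inj₁ (a , c , refl , c≢0) = inj₁ (step e a , c , refl , c≢0)
  ... | no u≢x   | inj₂ x∉r                 = inj₂ λ where
    zero    _         → u≢x
    (suc k) (s≤s k<l) → x∉r k k<l

  detour⊎distinct : ∀ {u v} (r : Reach G u v) → Detour r ⊎ DistinctVertices r
  detour⊎distinct here = inj₂ λ _ _ ()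
  detour⊎distinct {u} (step e r) with detour⊎distinct r
  ... | inj₁ d        = inj₁ (detour-step e d)
  ... | inj₂ distinct with splitAt? u r
  ...   | inj₁ (a , c , r≡a++c , c≢0) = inj₁ (record
          { junction = u ; prefix = here ; loop = step e a ; suffix = c
          ; splits = cong (step e) r≡a++c
          ; loop-nonempty = s≤s z≤n ; suffix-nonempty = c≢0 })
  ...   | inj₂ u∉r = inj₂ distinct′
    where
    distinct′ : DistinctVertices (step e r)
    distinct′ zero    zero    _         _         _  = refl
    distinct′ zero    (suc j) _         (s≤s j<l) eq = ⊥-elim (u∉r j j<l (≡-sym eq))
    distinct′ (suc i) zero    (s≤s i<l) _         eq = ⊥-elim (u∉r i i<l eq)
    distinct′ (suc i) (suc j) (s≤s i<l) (s≤s j<l) eq = cong suc (distinct i j i<l j<l eq)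

  length-detour : ∀ {u w v} (a : Reach G u w) (b : Reach G w w) (c : Reach G w v) →
                  length (a ++ b ++ c) ≡ length b + length (a ++ c)
  length-detour a b c = begin
    length (a ++ b ++ c)              ≡⟨ length-++ a (b ++ c) ⟩
    length a + length (b ++ c)        ≡⟨ cong (length a +_) (length-++ b c) ⟩
    length a + (length b + length c)  ≡⟨ x∙yz≈y∙xz +-commutativeSemigroup (length a) (length b) (length c) ⟩
    length b + (length a + length c)  ≡⟨ cong (length b +_) (length-++ a c) ⟨
    length b + length (a ++ c)        ∎

  loop-shorter : ∀ {u w v} (a : Reach G u w) (b : Reach G w w) (c : Reach G w v) →
                 0 < length c → length b < length (a ++ b ++ c)
  loop-shorter a b c c≢0 = subst (length b <_) (≡-sym (length-detour a b c))
    (m<m+n (length b) (subst (0 <_) (≡-sym (length-++ a c)) (≤-trans c≢0 (m≤n+m (length c) (length a)))))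

  shortcut-shorter : ∀ {u w v} (a : Reach G u w) (b : Reach G w w) (c : Reach G w v) →
                     0 < length b → length (a ++ c) < length (a ++ b ++ c)
  shortcut-shorter a b c b≢0 = subst (length (a ++ c) <_) (≡-sym (length-detour a b c)) (m<n+m _ b≢0)

  odd-detour : ∀ {u w v} (a : Reach G u w) (b : Reach G w w) (c : Reach G w v) →
               parity (length (a ++ b ++ c)) ≡ 1ℙ →
               parity (length b) ≡ 1ℙ ⊎ parity (length (a ++ c)) ≡ 1ℙ
  odd-detour a b c odd = p⊕q≡1ℙ⇒p≡1ℙ⊎q≡1ℙ (begin
    parity (length b) ⊕ parity (length (a ++ c))  ≡⟨ +-homo-+ (length b) (length (a ++ c)) ⟨
    parity (length b + length (a ++ c))           ≡⟨ cong parity (length-detour a b c) ⟨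
    parity (length (a ++ b ++ c))                 ≡⟨ odd ⟩
    1ℙ                                            ∎)

  closedWalk-length≢1 : ∀ {u} (r : Reach G u u) → length r ≢ 1
  closedWalk-length≢1 here                ()
  closedWalk-length≢1 (step e here)       _  = ~⇒≢ G e refl
  closedWalk-length≢1 (step _ (step _ _)) ()

  distinct⇒cycle : ∀ {u m} (r : Reach G u u) → length r ≡ suc m → 3 ≤ suc m →
                   DistinctVertices r → Cycle G m
  distinct⇒cycle {u} {m} r r≡1+m 3≤1+m distinct = record
    { vert      = λ i → vertex r (toℕ i)
    ; long      = 3≤1+m
    ; injective = λ {i} {j} eq → toℕ-injective (distinct _ _ (bound i) (bound j) eq)
    ; consec    = λ i → subst (λ k → (G ~ vertex r (toℕ (inject₁ i))) (vertex r (suc k)))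
                            (toℕ-inject₁ i) (vertex-adjacent r _ (bound (inject₁ i)))
    ; close     = subst (G ~ _) last≡first (vertex-adjacent r _ (bound (fromℕ m)))
    }
    where
    bound : ∀ (i : Fin (suc m)) → toℕ i < length r
    bound i = subst (toℕ i <_) (≡-sym r≡1+m) (toℕ<n i)
    last≡first : vertex r (suc (toℕ (fromℕ m))) ≡ vertex r 0
    last≡first = begin
      vertex r (suc (toℕ (fromℕ m)))  ≡⟨ cong (vertex r ∘ suc) (toℕ-fromℕ m) ⟩
      vertex r (suc m)                ≡⟨ cong (vertex r) r≡1+m ⟨
      vertex r (length r)             ≡⟨ vertex-length r ⟩
      u                               ≡⟨ vertex-zero r ⟨
      vertex r 0                      ∎

  OddCycle : Set
  OddCycle = Σ[ m ∈ ℕ ] Cycle G m × parity (suc m) ≡ 1ℙ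

  distinct-odd⇒oddCycle : ∀ {u} (r : Reach G u u) → DistinctVertices r →
                          parity (length r) ≡ 1ℙ → OddCycle
  distinct-odd⇒oddCycle r distinct = by-length (length r) refl
    where
    by-length : ∀ l → length r ≡ l → parity l ≡ 1ℙ → OddCycle
    by-length 1                   r≡1 _   = ⊥-elim (closedWalk-length≢1 r r≡1)
    by-length (suc (suc (suc k))) r≡l odd =
      suc (suc k) , distinct⇒cycle r r≡l (s≤s (s≤s (s≤s z≤n))) distinct , odd

  oddClosedWalk⇒oddCycle : ∀ {u} (r : Reach G u u) → parity (length r) ≡ 1ℙ → OddCycle
  oddClosedWalk⇒oddCycle r = go r (<-wellFounded (length r))
    where
    go : ∀ {u} (r : Reach G u u) → Acc _<_ (length r) → parity (length r) ≡ 1ℙ → OddCycle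
    go r (acc shorter) odd with detour⊎distinct r
    ... | inj₂ distinct = distinct-odd⇒oddCycle r distinct odd
    ... | inj₁ record { prefix = a ; loop = b ; suffix = c ; splits = refl
                      ; loop-nonempty = b≢0 ; suffix-nonempty = c≢0 }
      with odd-detour a b c odd
    ... | inj₁ b-odd  = go b (shorter (loop-shorter a b c c≢0)) b-odd
    ... | inj₂ ac-odd = go (a ++ c) (shorter (shortcut-shorter a b c b≢0)) ac-odd

ProperColouring : ∀ {n} → Graph n → (Fin n → Bool) → Set
ProperColouring G col = ∀ u v → (G ~ u) v → col u ≢ col v

NoOddCycle : ∀ {n} → Graph n → Set
NoOddCycle G = ∀ m → Cycle G m → parity (suc m) ≡ 0ℙ

noOddCycle⇒bipartite : ∀ {n} (G : Graph n) → Connected G → NoOddCycle G → Bipartite G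
noOddCycle⇒bipartite {zero}  G _         _          = (λ ()) , λ ()
noOddCycle⇒bipartite {suc n} G connected noOddCycle = isOdd ∘ depth , proper
  where
  open Walk G

  depth : Fin (suc n) → Parity
  depth v = parity (length (connected zero v))

  proper : ProperColouring G (isOdd ∘ depth)
  proper u v u~v same with oddClosedWalk⇒oddCycle closedWalk odd
    where
    toU : Reach G zero u
    toU = connected zero u
    toV : Reach G zero v
    toV = connected zero v
    closedWalk : Reach G u u
    closedWalk = step u~v (reverseAcc toU toV)
    odd : parity (length closedWalk) ≡ 1ℙ
    odd = begin
      parity (1 + length (reverseAcc toU toV))   ≡⟨ cong (parity ∘ suc) (length-reverseAcc toU toV) ⟩
      parity (1 + (length toV + length toU))     ≡⟨ +-homo-+ 1 (length toV + length toU) ⟩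
      1ℙ ⊕ parity (length toV + length toU)      ≡⟨ cong (1ℙ ⊕_) (+-homo-+ (length toV) (length toU)) ⟩
      1ℙ ⊕ (depth v ⊕ depth u)                   ≡⟨ cong (λ p → 1ℙ ⊕ (p ⊕ depth u)) (isOdd-injective (≡-sym same)) ⟩
      1ℙ ⊕ (depth u ⊕ depth u)                   ≡⟨ cong (1ℙ ⊕_) (p+p≡0ℙ (depth u)) ⟩
      1ℙ                                         ∎
  ... | m , cycle , odd-length with trans (≡-sym (noOddCycle m cycle)) odd-length
  ... | ()

𝟙 : Bool → ℕ
𝟙 b = if b then 1 else 0

𝟙-split : ∀ a b c → (a ≡ true → b ≡ not c) → 𝟙 (b ∧ a) + 𝟙 (c ∧ a) ≡ 𝟙 a
𝟙-split true  true  true  b≡¬c = contradiction (b≡¬c refl) λ ()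
𝟙-split true  true  false _    = refl
𝟙-split true  false true  _    = refl
𝟙-split true  false false b≡¬c = contradiction (b≡¬c refl) λ ()
𝟙-split false true  true  _    = refl
𝟙-split false true  false _    = refl
𝟙-split false false true  _    = refl
𝟙-split false false false _    = refl

<ᵇ-antisym : ∀ m n → m ≢ n → (m <ᵇ n) ≡ not (n <ᵇ m)
<ᵇ-antisym zero    zero    m≢n = contradiction refl m≢n
<ᵇ-antisym zero    (suc n) _   = refl
<ᵇ-antisym (suc m) zero    _   = refl
<ᵇ-antisym (suc m) (suc n) m≢n = <ᵇ-antisym m n (m≢n ∘ cong suc)

listSum-allFin : ∀ {n} (f : Fin n → ℕ) → List.sum (map f (allFin n)) ≡ ∑[ i < n ] f i
listSum-allFin {zero}  f = refl
listSum-allFin {suc n} f = cong (f zero +_) (begin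
  List.sum (map f (tabulate suc))          ≡⟨ cong List.sum (map-tabulate suc f) ⟩
  List.sum (tabulate (f ∘ suc))            ≡⟨ cong List.sum (map-tabulate id (f ∘ suc)) ⟨
  List.sum (map (f ∘ suc) (allFin n))      ≡⟨ listSum-allFin (f ∘ suc) ⟩
  ∑[ i < n ] f (suc i)                     ∎)

∑-even : ∀ {n} (f : Fin n → ℕ) → (∀ i → parity (f i) ≡ 0ℙ) → parity (∑[ i < n ] f i) ≡ 0ℙ
∑-even {zero}  f _    = refl
∑-even {suc n} f even = begin
  parity (f zero + ∑[ i < n ] f (suc i))          ≡⟨ +-homo-+ (f zero) _ ⟩
  parity (f zero) ⊕ parity (∑[ i < n ] f (suc i)) ≡⟨ cong₂ _⊕_ (even zero) (∑-even (f ∘ suc) (even ∘ suc)) ⟩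
  0ℙ                                              ∎

double-count : ∀ {n} (g h : Fin n → Fin n → ℕ) → (∀ i j → g i j + g j i ≡ h i j) →
               2 * ∑[ i < n ] ∑[ j < n ] g i j ≡ ∑[ i < n ] ∑[ j < n ] h i j
double-count {n} g h g+gᵀ≡h = begin
  2 * S                                                  ≡⟨ cong (S +_) (+-identityʳ S) ⟩
  S + S                                                  ≡⟨ cong (S +_) (∑-comm g) ⟩
  S + ∑[ i < n ] ∑[ j < n ] g j i                        ≡⟨ ∑-distrib-+ (λ i → ∑[ j < n ] g i j) _ ⟨
  ∑[ i < n ] (∑[ j < n ] g i j + ∑[ j < n ] g j i)       ≡⟨ sum-cong-≗ (λ i → ∑-distrib-+ (g i) (λ j → g j i)) ⟨
  ∑[ i < n ] ∑[ j < n ] (g i j + g j i)                  ≡⟨ sum-cong-≗ (λ i → sum-cong-≗ (g+gᵀ≡h i)) ⟩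
  ∑[ i < n ] ∑[ j < n ] h i j                            ∎
  where
  S : ℕ
  S = ∑[ i < n ] ∑[ j < n ] g i j

module _ {n} (G : Graph n) where

  edgeCount-double : 2 * edgeCount G ≡ ∑[ i < n ] ∑[ j < n ] 𝟙 (Adj G i j)
  edgeCount-double = begin
    2 * edgeCount G                      ≡⟨ cong (2 *_) edgeCount≡∑∑ ⟩
    2 * ∑[ i < n ] ∑[ j < n ] edge i j   ≡⟨ double-count edge _ ordered-pair ⟩
    ∑[ i < n ] ∑[ j < n ] 𝟙 (Adj G i j)  ∎
    where
    edge : Fin n → Fin n → ℕ
    edge i j = 𝟙 ((toℕ i <ᵇ toℕ j) ∧ Adj G i j)
    edgeCount≡∑∑ : edgeCount G ≡ ∑[ i < n ] ∑[ j < n ] edge i j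
    edgeCount≡∑∑ = trans (listSum-allFin (λ i → List.sum (map (edge i) (allFin n))))
                         (sum-cong-≗ (λ i → listSum-allFin (edge i)))
    ordered-pair : ∀ i j → 𝟙 ((toℕ i <ᵇ toℕ j) ∧ Adj G i j) + 𝟙 ((toℕ j <ᵇ toℕ i) ∧ Adj G j i)
                           ≡ 𝟙 (Adj G i j)
    ordered-pair i j rewrite Graph.sym G j i = 𝟙-split (Adj G i j) _ _ λ i~j →
      <ᵇ-antisym (toℕ i) (toℕ j) (~⇒≢ G i~j ∘ toℕ-injective)

  properColouring-double : (col : Fin n → Bool) → ProperColouring G col →
    2 * ∑[ i < n ] ∑[ j < n ] 𝟙 (col i ∧ Adj G i j) ≡ ∑[ i < n ] ∑[ j < n ] 𝟙 (Adj G i j)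
  properColouring-double col proper = double-count _ _ coloured-pair
    where
    coloured-pair : ∀ i j → 𝟙 (col i ∧ Adj G i j) + 𝟙 (col j ∧ Adj G j i) ≡ 𝟙 (Adj G i j)
    coloured-pair i j rewrite Graph.sym G j i = 𝟙-split (Adj G i j) (col i) (col j) (¬-not ∘ proper i j)

  bipartite-edgeCount : (col : Fin n → Bool) → ProperColouring G col →
    edgeCount G ≡ ∑[ i < n ] ∑[ j < n ] 𝟙 (col i ∧ Adj G i j)
  bipartite-edgeCount col proper =
    *-cancelˡ-≡ _ _ 2 (trans edgeCount-double (≡-sym (properColouring-double col proper)))

  bipartite-edgeCount-even : Bipartite G → (∀ v → 2 ∣ degree G v) → parity (edgeCount G) ≡ 0ℙ
  bipartite-edgeCount-even (col , proper) evenDegree =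
    trans (cong parity (bipartite-edgeCount col proper)) (∑-even _ row-even)
    where
    row-even : ∀ i → parity (∑[ j < n ] 𝟙 (col i ∧ Adj G i j)) ≡ 0ℙ
    row-even i with col i
    ... | false = cong parity (sum-replicate-zero n)
    ... | true  = trans (cong parity (≡-sym (listSum-allFin (𝟙 ∘ Adj G i)))) (2∣⇒even (evenDegree i))

theorem10 : ∀ (p q : ℕ) (G : Graph p) → InE₂ G → edgeCount G ≡ q →
    Bipartite G × (q % 4 ≡ 0 ⊎ q % 4 ≡ 2)
theorem10 p q G ((connected , evenDegree) , cycleLength) refl =
  bipartite , even⇒%4≡0∨2 (edgeCount G) (bipartite-edgeCount-even G bipartite evenDegree)
  where
  bipartite : Bipartite G
  bipartite = noOddCycle⇒bipartite G connected λ m cycle → %4≡2⇒even (suc m) (cycleLength m cycle)
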